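{- Let $p>11$ be a prime with $p\equiv 5\pmod 6$, and let $S=\{x\in\{1,2,\dots,\frac{p-5}{6}\}: x\equiv 1\pmod 3\}$, viewed as a subset of $\mathbb{F}_p$. Then for any $x,y,z,t\in S$ we have, in $\mathbb{F}_p$, $x+y\ne 0$, $x+y+z+t\ne 0$, $x+5y\ne 0$ and $x^{2}+xy+y^{2}\ne 0$. -}

module Defs where

open import Data.Nat using (ℕ; _≤_; _%_; _/_; _∸_)
open import Data.Product using (_×_)
open import Relation.Binary.PropositionalEquality using (_≡_)

-- S = { x ∈ {1, …, (p-5)/6} : x ≡ 1 (mod 3) }, as a predicate on ℕ.
-- Elements are viewed in F_p via reduction mod p.
InS : ℕ → ℕ → Set
InS p x = (1 ≤ x × x ≤ (p ∸ 5) / 6) × x % 3 ≡ 1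

module Submission where

-- The three linear forms are positive and at most 6 · max S ≤ p − 5, so p cannot divide them.
-- If p ∣ x² + xy + y², then x³ ≡ y³ because x³ − y³ = (x − y)(x² + xy + y²). Since
-- p = 3j + 2, Fermat's little theorem gives x · (x³)^(2j+1) = x^(2p) ≡ x², so cubing is
-- inverted by raising to the power 2j + 1; hence x ≡ y and x² + xy + y² ≡ 3x², which p does
-- not divide. Fermat's theorem comes from the binomial theorem, as p ∣ (p choose k) for 0 < k < p.

open import Data.Nat.Properties
open import Algebra.Properties.Monoid.Sum +-0-monoid using (sum; sum-cong-≗; sum-init-last)
open import Algebra.Properties.Semiring.Exp +-*-semiring using () renaming (_^_ to _^ₛ_)
open import Algebra.Properties.Semiring.Mult +-*-semiring using () renaming (_×_ to _×ₛ_)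
import Algebra.Properties.CommutativeSemiring.Binomial +-*-commutativeSemiring as Binomial
open import Data.Fin.Base using (Fin; zero; suc; toℕ; fromℕ)
open import Data.Fin.Properties using (toℕ-fromℕ; toℕ-inject₁; toℕ<n)
open import Data.Nat.Base
open import Data.Nat.Combinatorics using (_C_; nCn≡1; nCk≡n!/k![n-k]!; k![n∸k]!∣n!)
open import Data.Nat.DivMod using (_%_; _/_; %-distribˡ-+; %-distribˡ-*; %-remove-+ʳ; %-remove-+ˡ; m≡m%n+[m/n]*n; m*[n/m]≡n; m/n*n≤m; m∣n⇒o%n%m≡o%m)
open import Data.Nat.Divisibility
open import Data.Nat.Primality using (Prime; euclidsLemma; prime⇒nonZero; ¬prime[1])
open import Data.Nat.Tactic.RingSolver using (solve-∀)
open import Data.Product using (_×_; _,_)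
open import Data.Sum using ([_,_]; inj₁; inj₂)
open import Data.Vec.Functional using (init; last)
open import Function using (id; _∘_; flip)
open import Relation.Nullary using (¬_; contradiction)
open import Relation.Binary.PropositionalEquality using (_≡_; refl; sym; trans; cong; cong₂; subst; module ≡-Reasoning)

open import Defs

infix 4 _≡_mod_
_≡_mod_ : ℕ → ℕ → (n : ℕ) → .{{NonZero n}} → Set
a ≡ b mod n = a % n ≡ b % n

module _ {n : ℕ} .{{_ : NonZero n}} where

  +-cong-mod : ∀ {a b c d} → a ≡ b mod n → c ≡ d mod n → a + c ≡ b + d mod n
  +-cong-mod {a} {b} {c} {d} a≡b c≡d = begin
    (a + c) % n          ≡⟨ %-distribˡ-+ a c n ⟩
    (a % n + c % n) % n  ≡⟨ cong₂ (λ u v → (u + v) % n) a≡b c≡d ⟩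
    (b % n + d % n) % n  ≡⟨ %-distribˡ-+ b d n ⟨
    (b + d) % n          ∎
    where open ≡-Reasoning

  *-cong-mod : ∀ {a b c d} → a ≡ b mod n → c ≡ d mod n → a * c ≡ b * d mod n
  *-cong-mod {a} {b} {c} {d} a≡b c≡d = begin
    (a * c) % n            ≡⟨ %-distribˡ-* a c n ⟩
    (a % n * (c % n)) % n  ≡⟨ cong₂ (λ u v → (u * v) % n) a≡b c≡d ⟩
    (b % n * (d % n)) % n  ≡⟨ %-distribˡ-* b d n ⟨
    (b * d) % n            ∎
    where open ≡-Reasoning

  +-congˡ-mod : ∀ a {c d} → c ≡ d mod n → a + c ≡ a + d mod n
  +-congˡ-mod a = +-cong-mod {a} refl

  *-congˡ-mod : ∀ a {c d} → c ≡ d mod n → a * c ≡ a * d mod n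
  *-congˡ-mod a = *-cong-mod {a} refl

  ^-cong-mod : ∀ {a b} k → a ≡ b mod n → a ^ k ≡ b ^ k mod n
  ^-cong-mod zero    a≡b = refl
  ^-cong-mod (suc k) a≡b = *-cong-mod a≡b (^-cong-mod k a≡b)

  ≡-mod⇒∣∸ : ∀ {a b} → a ≡ b mod n → n ∣ b ∸ a
  ≡-mod⇒∣∸ {a} {b} a≡b = divides (b / n ∸ a / n) (begin
    b ∸ a                                      ≡⟨ cong₂ _∸_ (m≡m%n+[m/n]*n b n) (m≡m%n+[m/n]*n a n) ⟩
    (b % n + b / n * n) ∸ (a % n + a / n * n)  ≡⟨ cong (λ r → (b % n + b / n * n) ∸ (r + a / n * n)) a≡b ⟩
    (b % n + b / n * n) ∸ (b % n + a / n * n)  ≡⟨ [m+n]∸[m+o]≡n∸o (b % n) _ _ ⟩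
    b / n * n ∸ a / n * n                      ≡⟨ *-distribʳ-∸ n (b / n) (a / n) ⟨
    (b / n ∸ a / n) * n                        ∎)
    where open ≡-Reasoning

  ∣∸⇒≡-mod : ∀ {a b} → a ≤ b → n ∣ b ∸ a → a ≡ b mod n
  ∣∸⇒≡-mod {a} {b} a≤b n∣b∸a = sym (begin
    b % n              ≡⟨ cong (_% n) (m+[n∸m]≡n a≤b) ⟨
    (a + (b ∸ a)) % n  ≡⟨ %-remove-+ʳ a n∣b∸a ⟩
    a % n              ∎)
    where open ≡-Reasoning

n∣n! : ∀ n .{{_ : NonZero n}} → n ∣ n !
n∣n! (suc n) = m∣m*n (n !)

module _ {p : ℕ} .{{_ : NonZero p}} (p-prime : Prime p) where

  ∣*∧∤⇒∣ : ∀ {m n} → p ∣ m * n → p ∤ m → p ∣ n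
  ∣*∧∤⇒∣ {m} {n} p∣mn p∤m = [ flip contradiction p∤m , id ] (euclidsLemma m n p-prime p∣mn)

  p∤k! : ∀ {k} → k < p → p ∤ k !
  p∤k! {zero}  _   p∣1   = ¬prime[1] (subst Prime (∣1⇒≡1 p∣1) p-prime)
  p∤k! {suc k} k<p p∣k! = [ >⇒∤ k<p , p∤k! (<-trans (n<1+n k) k<p) ] (euclidsLemma (suc k) (k !) p-prime p∣k!)

  p∣pCk : ∀ {k} → 0 < k → k < p → p ∣ p C k
  p∣pCk {k} 0<k k<p = ∣*∧∤⇒∣ p∣k![p∸k]!*C p∤k![p∸k]!
    where
    k≤p = <⇒≤ k<p
    instance _ = k !* (p ∸ k) !≢0
    p∣k![p∸k]!*C : p ∣ (k ! * (p ∸ k) !) * (p C k)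
    p∣k![p∸k]!*C = subst (p ∣_) (sym (begin
      (k ! * (p ∸ k) !) * (p C k)                   ≡⟨ cong ((k ! * (p ∸ k) !) *_) (nCk≡n!/k![n-k]! k≤p) ⟩
      (k ! * (p ∸ k) !) * (p ! / (k ! * (p ∸ k) !)) ≡⟨ m*[n/m]≡n (k![n∸k]!∣n! k≤p) ⟩
      p !                                           ∎)) (n∣n! p)
      where open ≡-Reasoning
    p∤k![p∸k]! : p ∤ k ! * (p ∸ k) !
    p∤k![p∸k]! p∣ = [ p∤k! k<p , p∤k! (∸-monoʳ-< 0<k k≤p) ] (euclidsLemma (k !) ((p ∸ k) !) p-prime p∣)

  ∣∸-cancelˡ-* : ∀ {c a b} → p ∤ c → c * a ≡ c * b mod p → p ∣ b ∸ a
  ∣∸-cancelˡ-* {c} {a} {b} p∤c ca≡cb = ∣*∧∤⇒∣ (subst (p ∣_) (sym (*-distribˡ-∸ c b a)) (≡-mod⇒∣∸ ca≡cb)) p∤c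

  *-cancelˡ-mod : ∀ {c a b} → p ∤ c → c * a ≡ c * b mod p → a ≡ b mod p
  *-cancelˡ-mod {c} {a} {b} p∤c ca≡cb with ≤-total a b
  ... | inj₁ a≤b = ∣∸⇒≡-mod a≤b (∣∸-cancelˡ-* p∤c ca≡cb)
  ... | inj₂ b≤a = sym (∣∸⇒≡-mod b≤a (∣∸-cancelˡ-* p∤c (sym ca≡cb)))

^ₛ≡^ : ∀ a n → a ^ₛ n ≡ a ^ n
^ₛ≡^ a zero    = refl
^ₛ≡^ a (suc n) = cong (a *_) (^ₛ≡^ a n)

×ₛ≡* : ∀ n a → n ×ₛ a ≡ n * a
×ₛ≡* zero    a = refl
×ₛ≡* (suc n) a = cong (a +_) (×ₛ≡* n a)

binomial-theorem : ∀ a b n →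
  (a + b) ^ n ≡ sum (λ (k : Fin (suc n)) → (n C toℕ k) * (a ^ toℕ k * b ^ (n ∸ toℕ k)))
binomial-theorem a b n = begin
  (a + b) ^ n                       ≡⟨ ^ₛ≡^ (a + b) n ⟨
  (a + b) ^ₛ n                      ≡⟨ Binomial.theorem n a b ⟩
  Binomial.binomialExpansion a b n  ≡⟨ sum-cong-≗ term≡ ⟩
  _                                 ∎
  where
  open ≡-Reasoning
  term≡ : ∀ k → Binomial.binomialTerm a b n k ≡ (n C toℕ k) * (a ^ toℕ k * b ^ (n ∸ toℕ k))
  term≡ k = trans (×ₛ≡* (n C toℕ k) _) (cong ((n C toℕ k) *_) (cong₂ _*_ (^ₛ≡^ a (toℕ k)) (^ₛ≡^ b (n ∸ toℕ k))))

∣-sum : ∀ {d n} (f : Fin n → ℕ) → (∀ i → d ∣ f i) → d ∣ sum f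
∣-sum {n = zero}  f d∣f = _ ∣0
∣-sum {n = suc n} f d∣f = ∣m∣n⇒∣m+n (d∣f zero) (∣-sum (f ∘ suc) (d∣f ∘ suc))

frobenius-+ : ∀ {p} .{{_ : NonZero p}} → Prime p → ∀ a b → (a + b) ^ p ≡ a ^ p + b ^ p mod p
frobenius-+ {zero} ()
frobenius-+ {p@(suc q)} p-prime a b = begin
  (a + b) ^ p % p                ≡⟨ cong (_% p) (binomial-theorem a b p) ⟩
  sum term % p                   ≡⟨ cong (_% p) (cong₂ _+_ first (trans (sum-init-last (term ∘ suc)) (cong (inner +_) final))) ⟩
  (b ^ p + (inner + a ^ p)) % p  ≡⟨ cong (_% p) (rearrange (b ^ p) inner (a ^ p)) ⟩
  (inner + (a ^ p + b ^ p)) % p  ≡⟨ %-remove-+ˡ (a ^ p + b ^ p) (∣-sum (init (term ∘ suc)) p∣inner) ⟩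
  (a ^ p + b ^ p) % p            ∎
  where
  open ≡-Reasoning
  term : Fin (suc p) → ℕ
  term k = (p C toℕ k) * (a ^ toℕ k * b ^ (p ∸ toℕ k))
  inner = sum (init (term ∘ suc))
  first : term zero ≡ b ^ p
  first = trans (*-identityˡ _) (*-identityˡ (b ^ p))
  final : last (term ∘ suc) ≡ a ^ p
  final = begin
    (p C toℕ (suc (fromℕ q))) * (a ^ toℕ (suc (fromℕ q)) * b ^ (p ∸ toℕ (suc (fromℕ q))))
      ≡⟨ cong (λ k → (p C k) * (a ^ k * b ^ (p ∸ k))) (cong suc (toℕ-fromℕ q)) ⟩
    (p C p) * (a ^ p * b ^ (p ∸ p))
      ≡⟨ cong₂ (λ c e → c * (a ^ p * b ^ e)) (nCn≡1 p) (n∸n≡0 p) ⟩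
    1 * (a ^ p * 1)
      ≡⟨ trans (*-identityˡ _) (*-identityʳ (a ^ p)) ⟩
    a ^ p ∎
  p∣inner : ∀ j → p ∣ init (term ∘ suc) j
  p∣inner j = ∣-trans (p∣pCk p-prime (s≤s z≤n) (s≤s (subst (_< q) (sym (toℕ-inject₁ j)) (toℕ<n j)))) (m∣m*n _)
  rearrange : ∀ u v w → u + (v + w) ≡ v + (w + u)
  rearrange = solve-∀

fermat : ∀ {p} .{{_ : NonZero p}} → Prime p → ∀ a → a ^ p ≡ a mod p
fermat {zero} ()
fermat {suc q} p-prime zero    = refl
fermat {p}     p-prime (suc a) = begin
  (1 + a) ^ p % p      ≡⟨ frobenius-+ p-prime 1 a ⟩
  (1 ^ p + a ^ p) % p  ≡⟨ +-cong-mod (cong (_% p) (^-zeroˡ p)) (fermat p-prime a) ⟩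
  (1 + a) % p          ∎
  where open ≡-Reasoning

%3≡2⇒∤3 : ∀ {p} → p % 3 ≡ 2 → p ∤ 3
%3≡2⇒∤3 {0} ()
%3≡2⇒∤3 {1} ()
%3≡2⇒∤3 {2} _ 2∣3 = contradiction (n∣m⇒m%n≡0 3 2 2∣3) λ ()
%3≡2⇒∤3 {3} ()
%3≡2⇒∤3 {suc (suc (suc (suc _)))} _ p∣3 = contradiction (∣⇒≤ p∣3) λ { (s≤s (s≤s (s≤s ()))) }

module _ {p : ℕ} .{{_ : NonZero p}} (p-prime : Prime p) (p%3≡2 : p % 3 ≡ 2) where

  cube-root : ∀ {x} → p ∤ x → (x ^ 3) ^ (2 * (p / 3) + 1) ≡ x mod p
  cube-root {x} p∤x = *-cancelˡ-mod p-prime p∤x (begin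
    (x * (x ^ 3) ^ e) % p  ≡⟨ cong (λ y → (x * y) % p) (^-*-assoc x 3 e) ⟩
    x ^ (1 + 3 * e) % p    ≡⟨ cong (λ n → x ^ n % p) 1+3e≡p+p ⟩
    x ^ (p + p) % p        ≡⟨ cong (_% p) (^-distribˡ-+-* x p p) ⟩
    (x ^ p * x ^ p) % p    ≡⟨ *-cong-mod (fermat p-prime x) (fermat p-prime x) ⟩
    (x * x) % p            ∎)
    where
    open ≡-Reasoning
    j = p / 3
    e = 2 * j + 1
    1+3e≡p+p : 1 + 3 * e ≡ p + p
    1+3e≡p+p = begin
      1 + 3 * (2 * j + 1)                ≡⟨ 1+3[2j+1]≡[2+3j]+[2+3j] j ⟩
      (2 + j * 3) + (2 + j * 3)          ≡⟨ cong (λ r → (r + j * 3) + (r + j * 3)) p%3≡2 ⟨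
      (p % 3 + j * 3) + (p % 3 + j * 3)  ≡⟨ cong₂ _+_ (m≡m%n+[m/n]*n p 3) (m≡m%n+[m/n]*n p 3) ⟨
      p + p                              ∎
      where
      1+3[2j+1]≡[2+3j]+[2+3j] : ∀ j → 1 + 3 * (2 * j + 1) ≡ (2 + j * 3) + (2 + j * 3)
      1+3[2j+1]≡[2+3j]+[2+3j] = solve-∀

  cube-injective : ∀ {x y} → p ∤ x → p ∤ y → x ^ 3 ≡ y ^ 3 mod p → x ≡ y mod p
  cube-injective p∤x p∤y x³≡y³ = trans (sym (cube-root p∤x)) (trans (^-cong-mod (2 * (p / 3) + 1) x³≡y³) (cube-root p∤y))

  ∤x²+xy+y² : ∀ {x y} → p ∤ x → p ∤ y → p ∤ x * x + x * y + y * y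
  ∤x²+xy+y² {x} {y} p∤x p∤y p∣Q = p∤x (∣*∧∤⇒∣ p-prime (∣*∧∤⇒∣ p-prime p∣3x² (%3≡2⇒∤3 p%3≡2)) p∤x)
    where
    open ≡-Reasoning
    Q = x * x + x * y + y * y
    x³≡y³ : x ^ 3 ≡ y ^ 3 mod p
    x³≡y³ = begin
      x ^ 3 % p           ≡⟨ %-remove-+ʳ (x ^ 3) (∣-trans p∣Q (n∣m*n y)) ⟨
      (x ^ 3 + y * Q) % p ≡⟨ cong (_% p) (x³+yQ≡y³+xQ x y) ⟩
      (y ^ 3 + x * Q) % p ≡⟨ %-remove-+ʳ (y ^ 3) (∣-trans p∣Q (n∣m*n x)) ⟩
      y ^ 3 % p           ∎
      where
      x³+yQ≡y³+xQ : ∀ x y → x * (x * (x * 1)) + y * (x * x + x * y + y * y)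
                          ≡ y * (y * (y * 1)) + x * (x * x + x * y + y * y)
      x³+yQ≡y³+xQ = solve-∀
    y≡x : y ≡ x mod p
    y≡x = sym (cube-injective p∤x p∤y x³≡y³)
    p∣3x² : p ∣ 3 * (x * x)
    p∣3x² = m%n≡0⇒n∣m (3 * (x * x)) p (begin
      3 * (x * x) % p              ≡⟨ cong (_% p) (3x²≡x²+x²+x² x) ⟩
      (x * x + x * x + x * x) % p  ≡⟨ +-cong-mod (+-congˡ-mod (x * x) (*-congˡ-mod x y≡x)) (*-cong-mod y≡x y≡x) ⟨
      Q % p                        ≡⟨ n∣m⇒m%n≡0 Q p p∣Q ⟩
      0                            ∎)
      where
      3x²≡x²+x²+x² : ∀ x → 3 * (x * x) ≡ x * x + x * x + x * x
      3x²≡x²+x²+x² = solve-∀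

6*[[n∸5]/6]<n : ∀ {n} → 5 ≤ n → 6 * ((n ∸ 5) / 6) < n
6*[[n∸5]/6]<n {n} 5≤n = begin-strict
  6 * ((n ∸ 5) / 6)  ≡⟨ *-comm 6 ((n ∸ 5) / 6) ⟩
  (n ∸ 5) / 6 * 6    ≤⟨ m/n*n≤m (n ∸ 5) 6 ⟩
  n ∸ 5              <⟨ ∸-monoʳ-< z<s 5≤n ⟩
  n                  ∎
  where open ≤-Reasoning

%6≡5⇒%3≡2 : ∀ {n} → n % 6 ≡ 5 → n % 3 ≡ 2
%6≡5⇒%3≡2 {n} n%6≡5 = trans (sym (m∣n⇒o%n%m≡o%m 3 6 n (divides 2 refl))) (cong (_% 3) n%6≡5)

6m≡2m+4m : ∀ m → 6 * m ≡ (m + m) + (m + m + m + m)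
6m≡2m+4m = solve-∀

2m≤6m : ∀ m → m + m ≤ 6 * m
2m≤6m m = subst (m + m ≤_) (sym (6m≡2m+4m m)) (m≤m+n (m + m) _)

4m≤6m : ∀ m → m + m + m + m ≤ 6 * m
4m≤6m m = subst (m + m + m + m ≤_) (sym (6m≡2m+4m m)) (m≤n+m _ (m + m))

-- Membership in S only bounds the elements.
lemma3p1 : (p : ℕ) → Prime p → 11 < p → p % 6 ≡ 5 →
    (x y z t : ℕ) → InS p x → InS p y → InS p z → InS p t →
    ¬ (p ∣ x + y) × ¬ (p ∣ x + y + z + t) × ¬ (p ∣ x + 5 * y)
      × ¬ (p ∣ x * x + x * y + y * y)
lemma3p1 p p-prime 11<p p%6≡5 x y z t ((0<x , x≤m) , _) ((0<y , y≤m) , _) ((_ , z≤m) , _) ((_ , t≤m) , _) =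
    ∤-below-6m (<-≤-trans 0<x (m≤m+n x y)) (≤-trans (+-mono-≤ x≤m y≤m) (2m≤6m m))
  , ∤-below-6m (<-≤-trans 0<x (≤-trans (m≤m+n x y) (≤-trans (m≤m+n (x + y) z) (m≤m+n (x + y + z) t))))
               (≤-trans (+-mono-≤ (+-mono-≤ (+-mono-≤ x≤m y≤m) z≤m) t≤m) (4m≤6m m))
  , ∤-below-6m (<-≤-trans 0<x (m≤m+n x (5 * y))) (+-mono-≤ x≤m (*-monoʳ-≤ 5 y≤m))
  , ∤x²+xy+y² p-prime (%6≡5⇒%3≡2 {p} p%6≡5) (∤-below-m 0<x x≤m) (∤-below-m 0<y y≤m)
  where
  instance _ = prime⇒nonZero p-prime
  m = (p ∸ 5) / 6
  ∤-below-6m : ∀ {n} → 0 < n → n ≤ 6 * m → p ∤ n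
  ∤-below-6m 0<n n≤6m = >⇒∤ {{>-nonZero 0<n}} (≤-<-trans n≤6m (6*[[n∸5]/6]<n (≤-trans (m≤m+n 5 6) (<⇒≤ 11<p))))
  ∤-below-m : ∀ {n} → 0 < n → n ≤ m → p ∤ n
  ∤-below-m 0<n n≤m = ∤-below-6m 0<n (≤-trans n≤m (m≤n*m m 6))
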